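{- Let $(u,v)$ be a bridge such that $t(v)=t(u,v)\le l_m$. Then the expression for $t(u,v)$ uses $\mathrm{minlevel}(v)$; that is, if $(u,v)$ is unmatched then $\mathrm{minlevel}(v)=\mathrm{evenlevel}(v)$, and if $(u,v)$ is matched then $\mathrm{minlevel}(v)=\mathrm{oddlevel}(v)$.
   Context: $G=(V,E)$ is a finite undirected graph with a matching $M$, with at least one unmatched vertex. Alternating paths are simple paths alternating between unmatched edges (not in $M$) and matched edges (in $M$), starting with an unmatched edge when starting at an unmatched vertex. $l_m$ is the minimum length of an augmenting path (alternating path between two distinct unmatched vertices), $\infty$ if none. $\mathrm{evenlevel}(v)$, $\mathrm{oddlevel}(v)$ are the minimum lengths of even, resp. odd, alternating paths from an unmatched vertex to $v$ ($\infty$ if none). $\mathrm{minlevel}(v)$ is the smaller of the two, and a $\mathrm{minlevel}(v)$ path is an alternating path from an unmatched vertex to $v$ of length $\mathrm{minlevel}(v)$. Tenacity of a vertex: $t(v)=\mathrm{evenlevel}(v)+\mathrm{oddlevel}(v)$; of an unmatched edge $(u,v)$: $t(u,v)=\mathrm{evenlevel}(u)+\mathrm{evenlevel}(v)+1$; of a matched edge $(u,v)$: $t(u,v)=\mathrm{oddlevel}(u)+\mathrm{oddlevel}(v)+1$. An edge $(u,v)$ is a prop if it is the last edge of some $\mathrm{minlevel}(v)$ path or of some $\mathrm{minlevel}(u)$ path; an edge that is not a prop is a bridge. -}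

module Defs where

open import Data.Nat using (ℕ; zero; suc; _+_; _≤_)
open import Data.Nat.Base using (_⊓_)
open import Data.Fin using (Fin)
open import Data.List using (List; []; _∷_; _++_; length)
open import Data.List.Relation.Unary.Unique.Propositional using (Unique)
open import Data.Maybe using (Maybe; just; nothing)
open import Data.Product using (Σ; ∃; ∃-syntax; _×_; _,_)
open import Data.Sum using (_⊎_)
open import Data.Unit using (⊤)
open import Data.Empty using (⊥)
open import Relation.Nullary using (¬_)
open import Relation.Binary.PropositionalEquality using (_≡_; _≢_)

ℕ∞ : Set
ℕ∞ = Maybe ℕ

∞ : ℕ∞
∞ = nothing

infixl 6 _+∞_
_+∞_ : ℕ∞ → ℕ∞ → ℕ∞
just a +∞ just b = just (a + b)
_      +∞ _      = nothing

min∞ : ℕ∞ → ℕ∞ → ℕ∞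
min∞ (just a) (just b) = just (a ⊓ b)
min∞ (just a) nothing  = just a
min∞ nothing  b        = b

infix 4 _≤∞_
_≤∞_ : ℕ∞ → ℕ∞ → Set
_        ≤∞ nothing = ⊤
nothing  ≤∞ just _  = ⊥
just a   ≤∞ just b  = a ≤ b

MinOf : (ℕ → Set) → ℕ∞ → Set
MinOf P (just k) = P k × (∀ j → P j → k ≤ j)
MinOf P nothing  = ∀ j → ¬ P j

IsEven IsOdd : ℕ → Set
IsEven k = ∃[ m ] k ≡ m + m
IsOdd  k = ∃[ m ] k ≡ suc (m + m)

record Graph : Set₁ where
  field
    n     : ℕ
    Adj   : Fin n → Fin n → Set
    sym   : ∀ {u v} → Adj u v → Adj v u
    irrefl : ∀ {u} → ¬ Adj u u

record Matching (G : Graph) : Set₁ where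
  open Graph G
  field
    M       : Fin n → Fin n → Set
    M⊆Adj   : ∀ {u v} → M u v → Adj u v
    M-sym   : ∀ {u v} → M u v → M v u
    M-func  : ∀ {u v w} → M u v → M u w → v ≡ w

-- type of the required next edge: unmatched (um) or matched (mt)
data Parity : Set where
  um mt : Parity

module _ (G : Graph) (Mt : Matching G) where
  open Graph G
  open Matching Mt

  Unmatched : Fin n → Set
  Unmatched v = ∀ w → ¬ M v w

  -- AltWalk b x v ys : the walk x ∷ ys ends at v, alternates, and its
  -- first edge is matched if b = true, unmatched if b = false.
  data AltWalk : Parity → Fin n → Fin n → List (Fin n) → Set where
    done : ∀ {b x} → AltWalk b x x []
    unm  : ∀ {x y v ys} → Adj x y → ¬ M x y →
           AltWalk mt y v ys → AltWalk um x v (y ∷ ys)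
    mat  : ∀ {x y v ys} → M x y →
           AltWalk um y v ys → AltWalk mt x v (y ∷ ys)

  record AltPath (v : Fin n) (k : ℕ) : Set where
    field
      start  : Fin n
      rest   : List (Fin n)
      free   : Unmatched start
      walk   : AltWalk um start v rest
      simple : Unique (start ∷ rest)
      len    : length rest ≡ k
    verts : List (Fin n)
    verts = start ∷ rest

  EvenLevel OddLevel : Fin n → ℕ∞ → Set
  EvenLevel v = MinOf (λ k → IsEven k × AltPath v k)
  OddLevel  v = MinOf (λ k → IsOdd  k × AltPath v k)

  IsAugmenting : ∀ {v k} → AltPath v k → Set
  IsAugmenting {v} p = Unmatched v × AltPath.start p ≢ v

  MinAugLength : ℕ∞ → Set
  MinAugLength = MinOf (λ k → Σ (Fin n) λ v → Σ (AltPath v k) IsAugmenting)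

  module Levels (evenlevel oddlevel : Fin n → ℕ∞) where

    minlevel : Fin n → ℕ∞
    minlevel v = min∞ (evenlevel v) (oddlevel v)

    tenacity : Fin n → ℕ∞
    tenacity v = evenlevel v +∞ oddlevel v

    EdgeTenacity : Fin n → Fin n → ℕ∞ → Set
    EdgeTenacity u v t =
      (¬ M u v → t ≡ evenlevel u +∞ evenlevel v +∞ just 1) ×
      (M u v → t ≡ oddlevel u +∞ oddlevel v +∞ just 1)

    LastEdgeOfMinlevelPath : Fin n → Fin n → Set
    LastEdgeOfMinlevelPath u v =
      Σ ℕ λ k → minlevel v ≡ just k × Σ (AltPath v k) λ p →
        Σ (List (Fin n)) λ pre → AltPath.verts p ≡ pre ++ (u ∷ v ∷ [])

    IsProp IsBridge : Fin n → Fin n → Set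
    IsProp u v = Adj u v × (LastEdgeOfMinlevelPath u v ⊎ LastEdgeOfMinlevelPath v u)
    IsBridge u v = Adj u v × ¬ IsProp u v

-- Write c = evenlevel(u) (unmatched case) or c = oddlevel(u) (matched case). The tenacity
-- equation t(v) = t(u,v) forces the other level of v to be c + 1. Continuing a level path
-- of u along (u,v) either revisits v, giving a path to v shorter than c, or reaches v in
-- exactly c + 1 steps with last edge (u,v); since (u,v) is a bridge the latter path is not
-- a minlevel(v) path. Either way minlevel(v) < c + 1, so the minimum is the level of the
-- same parity as the edge.
module Submission where

open import Defs
open import Data.Nat using (ℕ; zero; suc; _+_; _≤_; _<_; s≤s; z≤n)
open import Data.Nat.Properties
open import Data.Fin using (Fin)
open import Data.Fin.Properties using () renaming (_≟_ to _≟ᶠ_)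
open import Data.Maybe using (just; nothing)
open import Data.Maybe.Properties using (just-injective)
open import Data.Product using (∃-syntax; _×_; Σ; _,_; proj₁; proj₂)
open import Data.Sum using (_⊎_; inj₁; inj₂)
open import Data.Empty using (⊥-elim)
open import Data.List using (List; []; _∷_; _++_; length)
open import Data.List.Properties using (length-++; ++-assoc; ++-identityʳ)
open import Data.List.Relation.Unary.Any using (here; there)
open import Data.List.Relation.Unary.All using ([]; _∷_)
open import Data.List.Relation.Unary.All.Properties using (++⁻ˡ)
open import Data.List.Relation.Unary.Unique.Propositional using (Unique; []; _∷_)
import Data.List.Relation.Unary.Unique.Propositional.Properties as Unique
open import Relation.Nullary using (¬_; yes; no)
open import Relation.Binary.PropositionalEquality
open import Function using (_∘_)

opposite : Parity → Parity
opposite um = mt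
opposite mt = um

parityAfter : Parity → ℕ → Parity
parityAfter b zero    = b
parityAfter b (suc k) = parityAfter (opposite b) k

parityAfter-double : ∀ b m → parityAfter b (m + m) ≡ b
parityAfter-double b  zero    = refl
parityAfter-double um (suc m) rewrite +-suc m m = parityAfter-double um m
parityAfter-double mt (suc m) rewrite +-suc m m = parityAfter-double mt m

parityAfter-even : ∀ b {k} → IsEven k → parityAfter b k ≡ b
parityAfter-even b (m , refl) = parityAfter-double b m

parityAfter-odd : ∀ b {k} → IsOdd k → parityAfter b k ≡ opposite b
parityAfter-odd b (m , refl) = parityAfter-double (opposite b) m

even⊎odd : ∀ k → IsEven k ⊎ IsOdd k
even⊎odd zero = inj₁ (0 , refl)
even⊎odd (suc k) with even⊎odd k
... | inj₁ (m , refl) = inj₂ (m , refl)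
... | inj₂ (m , refl) = inj₁ (suc m , cong suc (sym (+-suc m m)))

MinOf-just : ∀ {P l k} → MinOf P l → l ≡ just k → P k
MinOf-just (Pk , _) refl = Pk

MinOf-≤ : ∀ {P} l {j} → MinOf P l → P j → l ≤∞ just j
MinOf-≤ (just k) (_ , least) Pj = least _ Pj
MinOf-≤ nothing  empty       Pj = empty _ Pj

min∞-≤ˡ : ∀ x y {j} → x ≤∞ just j → min∞ x y ≤∞ just j
min∞-≤ˡ (just a) (just b) a≤j = m≤n⇒m⊓o≤n b a≤j
min∞-≤ˡ (just a) nothing  a≤j = a≤j

min∞-≤ʳ : ∀ x y {j} → y ≤∞ just j → min∞ x y ≤∞ just j
min∞-≤ʳ (just a) (just b) b≤j = m≤n⇒o⊓m≤n a b≤j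
min∞-≤ʳ nothing  (just b) b≤j = b≤j

≤∞-weaken : ∀ x {i j} → x ≤∞ just i → i ≤ j → x ≤∞ just j
≤∞-weaken (just a) a≤i i≤j = ≤-trans a≤i i≤j

≤∞-pred : ∀ x {c} → x ≤∞ just (suc c) → x ≢ just (suc c) → x ≤∞ just c
≤∞-pred (just a) a≤1+c a≢1+c = m<1+n⇒m≤n (≤∧≢⇒< a≤1+c (λ eq → a≢1+c (cong just eq)))

min∞-selectˡ : ∀ x y {c} → y ≡ just (suc c) → min∞ x y ≤∞ just c → min∞ x y ≡ x
min∞-selectˡ (just a) (just _) {c} refl min≤c with ⊓-sel a (suc c)
... | inj₁ eq = cong just eq
... | inj₂ eq = ⊥-elim (1+n≰n (subst (_≤ c) eq min≤c))
min∞-selectˡ nothing  (just _) refl 1+c≤c = ⊥-elim (1+n≰n 1+c≤c)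

min∞-selectʳ : ∀ x y {c} → x ≡ just (suc c) → min∞ x y ≤∞ just c → min∞ x y ≡ y
min∞-selectʳ (just _) (just b) {c} refl min≤c with ⊓-sel (suc c) b
... | inj₁ eq = ⊥-elim (1+n≰n (subst (_≤ c) eq min≤c))
... | inj₂ eq = cong just eq
min∞-selectʳ (just _) nothing  refl 1+c≤c = ⊥-elim (1+n≰n 1+c≤c)

+∞-comm : ∀ x y → x +∞ y ≡ y +∞ x
+∞-comm (just a) (just b) = cong just (+-comm a b)
+∞-comm (just a) nothing  = refl
+∞-comm nothing  (just b) = refl
+∞-comm nothing  nothing  = refl

a+b≡c+a+1⇒b≡1+c : ∀ a b c → a + b ≡ c + a + 1 → b ≡ suc c
a+b≡c+a+1⇒b≡1+c a b c eq = +-cancelˡ-≡ a b (suc c) (begin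
  a + b         ≡⟨ eq ⟩
  c + a + 1     ≡⟨ +-comm (c + a) 1 ⟩
  suc (c + a)   ≡⟨ cong suc (+-comm c a) ⟩
  suc (a + c)   ≡⟨ +-suc a c ⟨
  a + suc c     ∎)
  where open ≡-Reasoning

x+y≡z+x+1⇒y≡1+z : ∀ x y z {k} → x +∞ y ≡ just k → just k ≡ z +∞ x +∞ just 1 →
                  ∃[ c ] z ≡ just c × y ≡ just (suc c)
x+y≡z+x+1⇒y≡1+z (just a) (just b) (just c) refl eq =
  c , refl , cong just (a+b≡c+a+1⇒b≡1+c a b c (just-injective eq))
x+y≡z+x+1⇒y≡1+z (just _) nothing _ ()
x+y≡z+x+1⇒y≡1+z nothing  _       _ ()

Unique-++⁻ˡ : ∀ {A : Set} (xs : List A) {ys} → Unique (xs ++ ys) → Unique xs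
Unique-++⁻ˡ []       _              = []
Unique-++⁻ˡ (x ∷ xs) (x∉ ∷ unique) = ++⁻ˡ xs x∉ ∷ Unique-++⁻ˡ xs unique

module AlternatingPaths (G : Graph) (Mt : Matching G) where
  open Graph G hiding (sym)
  open Matching Mt
  open import Data.List.Membership.DecPropositional (_≟ᶠ_ {n}) using (_∈_; _∉_; _∈?_)

  AltEdge : Parity → Fin n → Fin n → Set
  AltEdge um x y = Adj x y × ¬ M x y
  AltEdge mt x y = M x y

  AltWalk-snoc : ∀ {b x e w ys} → AltWalk G Mt b x e ys →
                 AltEdge (parityAfter b (length ys)) e w → AltWalk G Mt b x w (ys ++ w ∷ [])
  AltWalk-snoc {um} done (adj , ¬m) = unm adj ¬m done
  AltWalk-snoc {mt} done m          = mat m done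
  AltWalk-snoc (unm adj ¬m walk) e  = unm adj ¬m (AltWalk-snoc walk e)
  AltWalk-snoc (mat m walk)      e  = mat m (AltWalk-snoc walk e)

  AltWalk-target-unique : ∀ {b x e w ys} → AltWalk G Mt b x e ys → AltWalk G Mt b x w ys → e ≡ w
  AltWalk-target-unique done            done             = refl
  AltWalk-target-unique (unm _ _ walk) (unm _ _ walk′) = AltWalk-target-unique walk walk′
  AltWalk-target-unique (mat _ walk)   (mat _ walk′)   = AltWalk-target-unique walk walk′

  AltWalk-ends-in : ∀ {b x e ys} → AltWalk G Mt b x e ys → ∃[ pre ] x ∷ ys ≡ pre ++ e ∷ []
  AltWalk-ends-in done = [] , refl
  AltWalk-ends-in {x = x} (unm _ _ walk) with AltWalk-ends-in walk
  ... | pre , eq = x ∷ pre , cong (x ∷_) eq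
  AltWalk-ends-in {x = x} (mat _ walk) with AltWalk-ends-in walk
  ... | pre , eq = x ∷ pre , cong (x ∷_) eq

  AltWalk-prefix : ∀ {b x e w ys} → AltWalk G Mt b x e ys → w ∈ x ∷ ys →
                   ∃[ zs ] ∃[ tl ] ys ≡ zs ++ tl × AltWalk G Mt b x w zs
  AltWalk-prefix {ys = ys} _ (here refl) = [] , ys , refl , done
  AltWalk-prefix (unm adj ¬m walk) (there w∈) with AltWalk-prefix walk w∈
  ... | zs , tl , eq , walk′ = _ ∷ zs , tl , cong (_ ∷_) eq , unm adj ¬m walk′
  AltWalk-prefix (mat m walk) (there w∈) with AltWalk-prefix walk w∈
  ... | zs , tl , eq , walk′ = _ ∷ zs , tl , cong (_ ∷_) eq , mat m walk′

  AltPath-truncate : ∀ {x w c} (P : AltPath G Mt x c) → w ∈ AltPath.verts P → w ≢ x →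
                     ∃[ j ] j < c × AltPath G Mt w j
  AltPath-truncate {x} {c = c} P w∈P w≢x with AltWalk-prefix (AltPath.walk P) w∈P
  ... | zs , [] , eq , walk′ = ⊥-elim (w≢x (AltWalk-target-unique walk′ walk-on-zs))
    where
    open AltPath P
    walk-on-zs : AltWalk G Mt um start x zs
    walk-on-zs = subst (AltWalk G Mt um start x) (trans eq (++-identityʳ zs)) walk
  ... | zs , t ∷ tl , eq , walk′ = length zs , zs<c , record
      { start = start ; rest = zs ; free = free ; walk = walk′ ; len = refl
      ; simple = Unique-++⁻ˡ (start ∷ zs) (subst (λ l → Unique (start ∷ l)) eq simple) }
    where
    open AltPath P
    zs<c : length zs < c
    zs<c = subst (length zs <_)
             (trans (sym (length-++ zs)) (trans (cong length (sym eq)) len))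
             (m<m+n (length zs) (s≤s z≤n))

  AltPath-extend : ∀ {u v c} (P : AltPath G Mt u c) → AltEdge (parityAfter um c) u v →
                   v ∉ AltPath.verts P →
                   Σ (AltPath G Mt v (suc c)) λ Q → ∃[ pre ] AltPath.verts Q ≡ pre ++ u ∷ v ∷ []
  AltPath-extend {u} {v} {c} P e v∉P = Q , pre , last-edge
    where
    open AltPath P
    pre : List (Fin n)
    pre = proj₁ (AltWalk-ends-in walk)
    Q : AltPath G Mt v (suc c)
    Q = record
      { start = start ; rest = rest ++ v ∷ [] ; free = free
      ; walk = AltWalk-snoc walk (subst (λ l → AltEdge (parityAfter um l) u v) (sym len) e)
      ; simple = Unique.++⁺ simple ([] ∷ []) λ { (v∈ , here refl) → v∉P v∈ }
      ; len = trans (length-++ rest) (trans (cong (_+ 1) len) (+-comm c 1)) }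
    last-edge : start ∷ rest ++ v ∷ [] ≡ pre ++ u ∷ v ∷ []
    last-edge = trans (cong (_++ v ∷ []) (proj₂ (AltWalk-ends-in walk))) (++-assoc pre (u ∷ []) (v ∷ []))

  module _ (evenlevel oddlevel : Fin n → ℕ∞)
           (evenlevel-min : ∀ v → EvenLevel G Mt v (evenlevel v))
           (oddlevel-min : ∀ v → OddLevel G Mt v (oddlevel v)) where
    open Levels G Mt evenlevel oddlevel

    minlevel-≤-length : ∀ {v j} → AltPath G Mt v j → minlevel v ≤∞ just j
    minlevel-≤-length {v} {j} P with even⊎odd j
    ... | inj₁ even = min∞-≤ˡ (evenlevel v) (oddlevel v) (MinOf-≤ (evenlevel v) (evenlevel-min v) (even , P))
    ... | inj₂ odd  = min∞-≤ʳ (evenlevel v) (oddlevel v) (MinOf-≤ (oddlevel v) (oddlevel-min v) (odd , P))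

    minlevel-<-via-non-last-edge : ∀ {u v c} → AltPath G Mt u c → AltEdge (parityAfter um c) u v →
      u ≢ v → ¬ LastEdgeOfMinlevelPath u v → minlevel v ≤∞ just c
    minlevel-<-via-non-last-edge {v = v} P e u≢v not-last with v ∈? AltPath.verts P
    ... | yes v∈P with AltPath-truncate P v∈P (u≢v ∘ sym)
    ...   | j , j<c , R = ≤∞-weaken (minlevel v) (minlevel-≤-length R) (<⇒≤ j<c)
    minlevel-<-via-non-last-edge {v = v} {c} P e u≢v not-last | no v∉P
      with Q , pre , last-edge ← AltPath-extend P e v∉P =
      ≤∞-pred (minlevel v) (minlevel-≤-length Q)
        (λ minlevel≡ → not-last (suc c , minlevel≡ , Q , pre , last-edge))

lemma13 : (G : Graph) (Mt : Matching G) →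
    ∃[ s ] Unmatched G Mt s →
    (evenlevel oddlevel : Fin (Graph.n G) → ℕ∞) (lm : ℕ∞) →
    (∀ v → EvenLevel G Mt v (evenlevel v)) →
    (∀ v → OddLevel G Mt v (oddlevel v)) →
    MinAugLength G Mt lm →
    (u v : Fin (Graph.n G)) →
    Levels.IsBridge G Mt evenlevel oddlevel u v →
    (k : ℕ) →
    Levels.tenacity G Mt evenlevel oddlevel v ≡ just k →
    Levels.EdgeTenacity G Mt evenlevel oddlevel u v (just k) →
    just k ≤∞ lm →
    (¬ Matching.M Mt u v →
    Levels.minlevel G Mt evenlevel oddlevel v ≡ evenlevel v) ×
    (Matching.M Mt u v →
    Levels.minlevel G Mt evenlevel oddlevel v ≡ oddlevel v)
lemma13 G Mt _ ev od _ ev-min od-min _ u v (adj , not-prop) k tv≡k (unmatched-t , matched-t) _ =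
  unmatched-case , matched-case
  where
  open Graph G hiding (sym)
  open AlternatingPaths G Mt
  open Levels G Mt ev od

  below : ∀ {c} → AltPath G Mt u c → AltEdge (parityAfter um c) u v → minlevel v ≤∞ just c
  below P e = minlevel-<-via-non-last-edge ev od ev-min od-min P e
    (λ { refl → irrefl adj }) (λ last → not-prop (adj , inj₁ last))

  unmatched-case : ¬ Matching.M Mt u v → minlevel v ≡ ev v
  unmatched-case ¬m with x+y≡z+x+1⇒y≡1+z (ev v) (od v) (ev u) tv≡k (unmatched-t ¬m)
  ... | c , ev-u≡c , od-v≡1+c with MinOf-just (ev-min u) ev-u≡c
  ...   | even , P = min∞-selectˡ (ev v) (od v) od-v≡1+c
                       (below P (subst (λ b → AltEdge b u v) (sym (parityAfter-even um even)) (adj , ¬m)))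

  matched-case : Matching.M Mt u v → minlevel v ≡ od v
  matched-case m
    with x+y≡z+x+1⇒y≡1+z (od v) (ev v) (od u) (trans (+∞-comm (od v) (ev v)) tv≡k) (matched-t m)
  ... | c , od-u≡c , ev-v≡1+c with MinOf-just (od-min u) od-u≡c
  ...   | odd , P = min∞-selectʳ (ev v) (od v) ev-v≡1+c
                      (below P (subst (λ b → AltEdge b u v) (sym (parityAfter-odd um odd)) m))
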